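{- Let $G$ be a total reduction graph such that $S := S(G)$ is a numerical semigroup (so $\mathrm{Bal}(G)=1$). Then the sum $\sum_{e\in E(G)}\mathrm{Rem}(e)$ is a direct sum and $$\mathrm{Ap}(S, r(G)) = \bigoplus_{e \in E(G)} \mathrm{Rem}(e).$$
   Context: $\mathbb{N}$ = nonnegative integers; $\langle a\rangle := \{an : n\in\mathbb{N}\}$. For sets $A,B$, $A+B := \{a+b\}$; $C=A\oplus B$ means $C=A+B$ with unique representations (a sum of finitely many sets is direct if every element has a unique representation). For a (possibly infinite) family of sets containing $0$, $\sum_i A_i$ is the set of all finite sums of elements from distinct members. A reduction graph $G$ consists of a multicollection $V(G)$ of nodes (nonempty subsets of $\mathbb{N}$ containing $0$) and a finite set $E(G)$ of hyperedges; each edge $e$ has input nodes $B_j$ and output nodes $A_i$ and a finite remainder set $\mathrm{Rem}(e)$ with $\sum_i A_i + \sum_j B_j = (\sum_i A_i)\oplus\mathrm{Rem}(e)$, weight $w(e):=|\mathrm{Rem}(e)|$. Viewing edges as arrows from inputs to outputs, $G$ is acyclic; exactly one node (the root) is an input of no edge and equals $\langle r(G)\rangle$ for a positive integer $r(G)$; every other node is an input of exactly one edge. $S(G) := \sum_{X\in V(G)}X$. $\mathrm{Bal}(G) := r(G)/\prod_{e} w(e)$, and $G$ is total if $\mathrm{Bal}(G) = \gcd(S(G))$. A numerical semigroup is a submonoid $S$ of $\mathbb{N}$ with finite complement; for $a \in S\setminus\{0\}$, the Apéry set is $\mathrm{Ap}(S,a) := \{s\in S : s-a\notin S\}$. -}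

module Defs where

open import Data.Nat using (ℕ; zero; suc; _+_; _*_; _∸_; _≤_; _<_)
open import Data.Nat.Divisibility using (_∣_)
open import Data.Fin using (Fin; zero; suc)
open import Data.Bool using (Bool; true; false; if_then_else_)
open import Data.Maybe using (Maybe; just; nothing)
open import Data.List using (List; length)
open import Data.List.Membership.Propositional using (_∈_; _∉_)
open import Data.List.Relation.Unary.Unique.Propositional using (Unique)
open import Data.Product using (Σ; ∃; _×_; _,_)
open import Relation.Nullary using (¬_)
open import Relation.Binary.PropositionalEquality using (_≡_)
open import Level using (0ℓ)
open import Relation.Unary using (Pred)

SubsetN : Set₁
SubsetN = Pred ℕ 0ℓ

_≐_ : SubsetN → SubsetN → Set
A ≐ B = ∀ x → (A x → B x) × (B x → A x)

⟨_⟩ : ℕ → SubsetN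
⟨ a ⟩ x = Σ ℕ λ k → x ≡ a * k

Zero : SubsetN
Zero x = x ≡ 0

_⊞_ : SubsetN → SubsetN → SubsetN
(A ⊞ B) x = Σ ℕ λ a → Σ ℕ λ b → A a × B b × a + b ≡ x

DirectPair : SubsetN → SubsetN → Set
DirectPair A B = ∀ a a′ b b′ → A a → A a′ → B b → B b′ → a + b ≡ a′ + b′ → (a ≡ a′) × (b ≡ b′)

IsDirectSum : SubsetN → SubsetN → SubsetN → Set
IsDirectSum C A B = (C ≐ (A ⊞ B)) × DirectPair A B

sumFin : ∀ {k} → (Fin k → ℕ) → ℕ
sumFin {zero} f = 0
sumFin {suc k} f = f zero + sumFin (λ i → f (suc i))

prodFin : ∀ {k} → (Fin k → ℕ) → ℕ
prodFin {zero} f = 1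
prodFin {suc k} f = f zero * prodFin (λ i → f (suc i))

-- Σ_i A_i for a finite family (finite sums of elements from distinct members;
-- as all members contain 0, these are the sums Σ_i a_i with a_i ∈ A_i).
FamSum : ∀ {k} → (Fin k → SubsetN) → SubsetN
FamSum {k} A x = Σ (Fin k → ℕ) λ f → (∀ i → A i (f i)) × sumFin f ≡ x

FamDirect : ∀ {k} → (Fin k → SubsetN) → Set
FamDirect {k} A = ∀ (f g : Fin k → ℕ) → (∀ i → A i (f i)) → (∀ i → A i (g i))
  → sumFin f ≡ sumFin g → ∀ i → f i ≡ g i

-- restriction of a family of nodes to the sub-multicollection selected by P
-- (non-selected members replaced by {0}, which does not change the sum)
Restrict : ∀ {n} → (Fin n → Bool) → (Fin n → SubsetN) → Fin n → SubsetN
Restrict P X v = if P v then X v else Zero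

eqFin : ∀ {m} → Fin m → Fin m → Bool
eqFin zero zero = true
eqFin zero (suc j) = false
eqFin (suc i) zero = false
eqFin (suc i) (suc j) = eqFin i j

isInputOf : ∀ {m} → Maybe (Fin m) → Fin m → Bool
isInputOf nothing e = false
isInputOf (just e′) e = eqFin e′ e

data Path⁺ {A : Set} (R : A → A → Set) : A → A → Set where
  one  : ∀ {u v} → R u v → Path⁺ R u v
  more : ∀ {u v t} → R u v → Path⁺ R v t → Path⁺ R u t

-- Nodes: indexed by Fin n (a multicollection), node v is the set X v.
-- Edges: indexed by Fin m.
-- inp v = just e  : node v is an input of edge e (every non-root node is an
--                   input of exactly one edge); inp v = nothing : v is input of no edge.
-- out e v = true  : node v is an output of edge e.
-- rem e           : the finite set Rem(e), listed without repetition.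
record ReductionGraph : Set₁ where
  field
    n : ℕ
    m : ℕ
    X : Fin n → SubsetN
    X-zero : ∀ v → X v 0
    inp : Fin n → Maybe (Fin m)
    out : Fin m → Fin n → Bool
    rem : Fin m → List ℕ
    rem-unique : ∀ e → Unique (rem e)

  Inputs : Fin m → SubsetN
  Inputs e = FamSum (Restrict (λ v → isInputOf (inp v) e) X)

  Outputs : Fin m → SubsetN
  Outputs e = FamSum (Restrict (out e) X)

  Rem : Fin m → SubsetN
  Rem e x = x ∈ rem e

  w : Fin m → ℕ
  w e = length (rem e)

  Arrow : Fin n → Fin n → Set
  Arrow u v = Σ (Fin m) λ e → (inp u ≡ just e) × (out e v ≡ true)

  field
    edge-rem : ∀ e → IsDirectSum (Outputs e ⊞ Inputs e) (Outputs e) (Rem e)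
    root : Fin n
    root-unique : ∀ v → (inp v ≡ nothing → v ≡ root) × (v ≡ root → inp v ≡ nothing)
    r : ℕ
    r-pos : 0 < r
    root-set : X root ≐ ⟨ r ⟩

    acyclic : ∀ v → ¬ Path⁺ Arrow v v

  S : SubsetN
  S = FamSum X

  Bal-denominator : ℕ
  Bal-denominator = prodFin w

IsGcdOfSet : SubsetN → ℕ → Set
IsGcdOfSet A d = (∀ x → A x → d ∣ x) × (∀ c → (∀ x → A x → c ∣ x) → c ∣ d)

-- G is total: Bal(G) = r / Π w(e) equals gcd(S(G)), i.e. r = gcd(S) · Π w(e)
Total : ReductionGraph → Set
Total G = Σ ℕ λ d → IsGcdOfSet S d × r ≡ d * Bal-denominator
  where open ReductionGraph G

IsNumericalSemigroup : SubsetN → Set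
IsNumericalSemigroup A =
  A 0 × (∀ x y → A x → A y → A (x + y)) × (Σ (List ℕ) λ L → ∀ x → ¬ A x → x ∈ L)

-- Apéry set Ap(A, a) = { s ∈ A : s - a ∉ A } (s - a taken in ℤ)
Ap : SubsetN → ℕ → SubsetN
Ap A a s = A s × ¬ (Σ (a ≤ s) λ _ → A (s ∸ a))

module Submission where

-- Reducing the edges of G one at a time, each before every edge that consumes one of its outputs
-- (possible since G is acyclic), rewrites S as ⟨r⟩ + Σₑ Rem(e). Totality and gcd S = 1 give
-- r = Πₑ |Rem(e)|. Since S contains every large number, the r sums of choices from the Rem(e)
-- meet every residue class mod r; being only r many, they are pairwise incongruent mod r. Hence
-- Σₑ Rem(e) is direct, and an element σ + q r of S with σ ∈ Σₑ Rem(e) lies in Ap(S, r) iff q = 0.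

open import Defs
open import Level using (0ℓ) renaming (suc to lsuc)
open import Function using (_∘_; id)
open import Data.Bool using (Bool; true; false; if_then_else_; not; _∨_; _∧_)
open import Data.Bool.Properties using (∨-identityʳ)
open import Data.Maybe using (just; nothing; maybe′)
open import Data.Nat
  using (ℕ; zero; suc; _+_; _*_; _∸_; _≤_; _<_; z≤n; s≤s; _⊔_; _<?_; NonZero; >-nonZero; >-nonZero⁻¹; _%_)
  renaming (_≟_ to _≟ℕ_)
open import Data.Nat.Properties
open import Algebra.Properties.CommutativeSemigroup +-commutativeSemigroup using (x∙yz≈y∙xz)
open import Data.Nat.DivMod using (m%n<n; [m+kn]%n≡m%n; m<n⇒m%n≡m)
open import Data.Nat.Divisibility using (_∣_; _∣?_; ∣m+n∣m⇒∣n; ∣1⇒≡1)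
open import Data.Nat.ListAction using (sum)
open import Data.Fin using (Fin; zero; suc; toℕ; fromℕ<; combine; remQuot; punchOut)
open import Data.Fin.Properties
  using (any?; pigeonhole; toℕ<n; toℕ-injective; toℕ-fromℕ<; remQuot-combine; punchOut-injective; injective⇒≤)
  renaming (_≟_ to _≟F_)
open import Data.List using (List; _∷_; length; lookup)
open import Data.List.Relation.Unary.Any using (here; there; index)
open import Data.List.Relation.Unary.Any.Properties using (lookup-index)
open import Data.List.Membership.Propositional using (_∈_)
open import Data.Product using (Σ; ∃; ∃₂; _×_; _,_; proj₁; proj₂; swap)
open import Data.Sum using (_⊎_; inj₁; inj₂)
open import Relation.Nullary using (¬_; yes; no; does; contradiction)
open import Relation.Nullary.Decidable using (dec-true; dec-false)
open import Relation.Binary.Bundles using (Setoid)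
open import Relation.Binary.Structures using (IsEquivalence)
open import Relation.Binary.Definitions using (Decidable; tri<; tri≈; tri>)
open import Relation.Binary.PropositionalEquality
import Relation.Binary.Reasoning.Setoid as SetoidReasoning

module SetAlgebra where

  ≐-isEquivalence : IsEquivalence _≐_
  ≐-isEquivalence = record
    { refl  = λ _ → id , id
    ; sym   = λ A≐B x → swap (A≐B x)
    ; trans = λ A≐B B≐C x → proj₁ (B≐C x) ∘ proj₁ (A≐B x) , proj₂ (A≐B x) ∘ proj₂ (B≐C x)
    }

  ≐-setoid : Setoid (lsuc 0ℓ) 0ℓ
  ≐-setoid = record { isEquivalence = ≐-isEquivalence }

  open Setoid ≐-setoid public using ()
    renaming (refl to ≐-refl; sym to ≐-sym; trans to ≐-trans; reflexive to ≐-reflexive)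

  module ≐-Reasoning = SetoidReasoning ≐-setoid

  ⊞-cong : ∀ {A A′ B B′} → A ≐ A′ → B ≐ B′ → (A ⊞ B) ≐ (A′ ⊞ B′)
  ⊞-cong A≐A′ B≐B′ x =
    (λ (a , b , Aa , Bb , a+b≡x) → a , b , proj₁ (A≐A′ a) Aa , proj₁ (B≐B′ b) Bb , a+b≡x) ,
    (λ (a , b , Aa , Bb , a+b≡x) → a , b , proj₂ (A≐A′ a) Aa , proj₂ (B≐B′ b) Bb , a+b≡x)

  ⊞-congˡ : ∀ {A B B′} → B ≐ B′ → (A ⊞ B) ≐ (A ⊞ B′)
  ⊞-congˡ = ⊞-cong ≐-refl

  ⊞-congʳ : ∀ {A A′ B} → A ≐ A′ → (A ⊞ B) ≐ (A′ ⊞ B)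
  ⊞-congʳ A≐A′ = ⊞-cong A≐A′ ≐-refl

  ⊞-comm : ∀ {A B} → (A ⊞ B) ≐ (B ⊞ A)
  ⊞-comm x = flip , flip
    where
    flip : ∀ {A B} → (A ⊞ B) x → (B ⊞ A) x
    flip (a , b , Aa , Bb , a+b≡x) = b , a , Bb , Aa , trans (+-comm b a) a+b≡x

  ⊞-assoc : ∀ {A B C} → ((A ⊞ B) ⊞ C) ≐ (A ⊞ (B ⊞ C))
  ⊞-assoc x =
    (λ { (_ , c , (a , b , Aa , Bb , refl) , Cc , ab+c≡x) →
         a , b + c , Aa , (b , c , Bb , Cc , refl) , trans (sym (+-assoc a b c)) ab+c≡x }) ,
    (λ { (a , _ , Aa , (b , c , Bb , Cc , refl) , a+bc≡x) →
         a + b , c , (a , b , Aa , Bb , refl) , Cc , trans (+-assoc a b c) a+bc≡x })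

  ⊞-identityʳ : ∀ {A} → (A ⊞ Zero) ≐ A
  ⊞-identityʳ {A} x =
    (λ { (a , _ , Aa , refl , a+0≡x) → subst A (trans (sym (+-identityʳ a)) a+0≡x) Aa }) ,
    (λ Ax → x , 0 , Ax , refl , +-identityʳ x)

  ⊞-identityˡ : ∀ {A} → (Zero ⊞ A) ≐ A
  ⊞-identityˡ = ≐-trans ⊞-comm ⊞-identityʳ

  ⊞-medial : ∀ {A B C D} → ((A ⊞ B) ⊞ (C ⊞ D)) ≐ ((A ⊞ C) ⊞ (B ⊞ D))
  ⊞-medial {A} {B} {C} {D} = begin
    (A ⊞ B) ⊞ (C ⊞ D)  ≈⟨ ⊞-assoc ⟩
    A ⊞ (B ⊞ (C ⊞ D))  ≈⟨ ⊞-congˡ ⊞-assoc ⟨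
    A ⊞ ((B ⊞ C) ⊞ D)  ≈⟨ ⊞-congˡ (⊞-congʳ ⊞-comm) ⟩
    A ⊞ ((C ⊞ B) ⊞ D)  ≈⟨ ⊞-congˡ ⊞-assoc ⟩
    A ⊞ (C ⊞ (B ⊞ D))  ≈⟨ ⊞-assoc ⟨
    (A ⊞ C) ⊞ (B ⊞ D)  ∎
    where open ≐-Reasoning

  FamSum-nil : (A : Fin 0 → SubsetN) → FamSum A ≐ Zero
  FamSum-nil A x = (λ (_ , _ , 0≡x) → sym 0≡x) , λ { refl → (λ ()) , (λ ()) , refl }

  FamSum-cons : ∀ {k} (A : Fin (suc k) → SubsetN) → FamSum A ≐ (A zero ⊞ FamSum (A ∘ suc))
  FamSum-cons A x =
    (λ (f , f∈A , Σf≡x) → f zero , sumFin (f ∘ suc) , f∈A zero , (f ∘ suc , f∈A ∘ suc , refl) , Σf≡x) ,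
    (λ { (a , _ , a∈A₀ , (g , g∈A , refl) , a+Σg≡x) →
         (λ { zero → a ; (suc i) → g i }) , (λ { zero → a∈A₀ ; (suc i) → g∈A i }) , a+Σg≡x })

  FamSum-cong : ∀ {k} {A B : Fin k → SubsetN} → (∀ i → A i ≐ B i) → FamSum A ≐ FamSum B
  FamSum-cong A≐B x =
    (λ (f , f∈A , Σf≡x) → f , (λ i → proj₁ (A≐B i (f i)) (f∈A i)) , Σf≡x) ,
    (λ (f , f∈B , Σf≡x) → f , (λ i → proj₂ (A≐B i (f i)) (f∈B i)) , Σf≡x)

  FamSum-Zero : ∀ {k} → FamSum {k} (λ _ → Zero) ≐ Zero
  FamSum-Zero {zero} = FamSum-nil (λ _ → Zero)
  FamSum-Zero {suc k} = ≐-trans (FamSum-cons (λ _ → Zero)) (≐-trans (⊞-congˡ FamSum-Zero) ⊞-identityʳ)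

  FamSum-⊞ : ∀ {k} (A B : Fin k → SubsetN) → FamSum (λ i → A i ⊞ B i) ≐ (FamSum A ⊞ FamSum B)
  FamSum-⊞ {zero} A B =
    ≐-trans (FamSum-nil (λ i → A i ⊞ B i)) (≐-sym (≐-trans (⊞-cong (FamSum-nil A) (FamSum-nil B)) ⊞-identityʳ))
  FamSum-⊞ {suc k} A B = begin
    FamSum (λ i → A i ⊞ B i)                                    ≈⟨ FamSum-cons (λ i → A i ⊞ B i) ⟩
    (A zero ⊞ B zero) ⊞ FamSum (λ i → A (suc i) ⊞ B (suc i))    ≈⟨ ⊞-congˡ (FamSum-⊞ (A ∘ suc) (B ∘ suc)) ⟩
    (A zero ⊞ B zero) ⊞ (FamSum (A ∘ suc) ⊞ FamSum (B ∘ suc))   ≈⟨ ⊞-medial ⟩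
    (A zero ⊞ FamSum (A ∘ suc)) ⊞ (B zero ⊞ FamSum (B ∘ suc))   ≈⟨ ⊞-cong (FamSum-cons A) (FamSum-cons B) ⟨
    FamSum A ⊞ FamSum B                                         ∎
    where open ≐-Reasoning

  data Splits : Bool → Bool → Bool → Set where
    left  : Splits true true false
    right : Splits true false true
    none  : Splits false false false

  Restrict-splits : ∀ {k} {P Q R : Fin k → Bool} (A : Fin k → SubsetN) → (∀ i → Splits (P i) (Q i) (R i))
    → FamSum (Restrict P A) ≐ (FamSum (Restrict Q A) ⊞ FamSum (Restrict R A))
  Restrict-splits A splits = ≐-trans (FamSum-cong (λ i → split (A i) (splits i))) (FamSum-⊞ _ _)
    where
    split : ∀ {b c d} B → Splits b c d
      → (if b then B else Zero) ≐ ((if c then B else Zero) ⊞ (if d then B else Zero))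
    split B left  = ≐-sym ⊞-identityʳ
    split B right = ≐-sym ⊞-identityˡ
    split B none  = ≐-sym ⊞-identityʳ

  Restrict-cong : ∀ {k} {P Q : Fin k → Bool} (A : Fin k → SubsetN) → (∀ i → P i ≡ Q i)
    → FamSum (Restrict P A) ≐ FamSum (Restrict Q A)
  Restrict-cong A P≡Q = FamSum-cong λ i → ≐-reflexive (cong (λ b → if b then A i else Zero) (P≡Q i))

  FamSum-Restrict-eqFin : ∀ {k} (j : Fin k) (A : Fin k → SubsetN) → FamSum (Restrict (eqFin j) A) ≐ A j
  FamSum-Restrict-eqFin zero A =
    ≐-trans (FamSum-cons (Restrict (eqFin zero) A)) (≐-trans (⊞-congˡ FamSum-Zero) ⊞-identityʳ)
  FamSum-Restrict-eqFin (suc j) A =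
    ≐-trans (FamSum-cons (Restrict (eqFin (suc j)) A))
            (≐-trans (⊞-congˡ (FamSum-Restrict-eqFin j (A ∘ suc))) ⊞-identityˡ)

eqFin-refl : ∀ {k} (i : Fin k) → eqFin i i ≡ true
eqFin-refl zero = refl
eqFin-refl (suc i) = eqFin-refl i

eqFin-≢ : ∀ {k} {i j : Fin k} → i ≢ j → eqFin i j ≡ false
eqFin-≢ {i = zero}  {zero}  i≢j = contradiction refl i≢j
eqFin-≢ {i = zero}  {suc j} _   = refl
eqFin-≢ {i = suc i} {zero}  _   = refl
eqFin-≢ {i = suc i} {suc j} i≢j = eqFin-≢ (i≢j ∘ cong suc)

eqFin-sound : ∀ {k} {i j : Fin k} → eqFin i j ≡ true → i ≡ j
eqFin-sound {i = i} {j} eq with i ≟F j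
... | yes i≡j = i≡j
... | no i≢j = contradiction (trans (sym eq) (eqFin-≢ i≢j)) λ ()

maxFin : ∀ {k} → (Fin k → ℕ) → ℕ
maxFin {zero} f = 0
maxFin {suc k} f = f zero ⊔ maxFin (f ∘ suc)

≤-maxFin : ∀ {k} (f : Fin k → ℕ) i → f i ≤ maxFin f
≤-maxFin f zero = m≤m⊔n _ _
≤-maxFin f (suc i) = ≤-trans (≤-maxFin (f ∘ suc) i) (m≤n⊔m (f zero) _)

maxFin-lub : ∀ {k} (f : Fin k → ℕ) {b} → (∀ i → f i ≤ b) → maxFin f ≤ b
maxFin-lub {zero} f _ = z≤n
maxFin-lub {suc k} f f≤b = ⊔-lub (f≤b zero) (maxFin-lub (f ∘ suc) (f≤b ∘ suc))

maxFin-attained : ∀ {k} (f : Fin k → ℕ) → maxFin f ≡ 0 ⊎ ∃ λ i → maxFin f ≡ f i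
maxFin-attained {zero} f = inj₁ refl
maxFin-attained {suc k} f with ⊔-sel (f zero) (maxFin (f ∘ suc)) | maxFin-attained (f ∘ suc)
... | inj₁ ≡head | _               = inj₂ (zero , ≡head)
... | inj₂ ≡tail | inj₁ ≡0         = inj₁ (trans ≡tail ≡0)
... | inj₂ ≡tail | inj₂ (i , ≡f-i) = inj₂ (suc i , trans ≡tail ≡f-i)

snoc⁺ : ∀ {A : Set} {R : A → A → Set} {x u v} → Path⁺ R x u → R u v → Path⁺ R x v
snoc⁺ (one a) b = more a (one b)
snoc⁺ (more a p) b = more a (snoc⁺ p b)

-- The rank of a vertex is the length of the longest walk ending at it, which is < n by pigeonhole.
module Ranking {n : ℕ} {R : Fin n → Fin n → Set} (R? : Decidable R) (acyclic : ∀ v → ¬ Path⁺ R v v) where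

  data Walk : ℕ → Fin n → Set where
    []  : ∀ {v} → Walk 0 v
    _▷_ : ∀ {k u v} → Walk k u → R u v → Walk (suc k) v

  -- vertices indexed from the end of the walk
  vertex : ∀ {k v} → Walk k v → Fin (suc k) → Fin n
  vertex {v = v} _ zero = v
  vertex (w ▷ _) (suc i) = vertex w i

  path-to-end : ∀ {k v} (w : Walk k v) (j : Fin k) → Path⁺ R (vertex w (suc j)) v
  path-to-end (w ▷ a) zero = one a
  path-to-end (w ▷ a) (suc j) = snoc⁺ (path-to-end w j) a

  path-along : ∀ {k v} (w : Walk k v) {i j : Fin (suc k)} → toℕ i < toℕ j → Path⁺ R (vertex w j) (vertex w i)
  path-along w {zero} {suc j} _ = path-to-end w j
  path-along (w ▷ _) {suc i} {suc j} (s≤s i<j) = path-along w i<j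

  walk-length< : ∀ {k v} → Walk k v → k < n
  walk-length< {k} w with k <? n
  ... | yes k<n = k<n
  ... | no k≮n with i , j , i<j , vᵢ≡vⱼ ← pigeonhole (s≤s (≮⇒≥ k≮n)) (vertex w) =
    contradiction (subst (λ u → Path⁺ R u (vertex w i)) (sym vᵢ≡vⱼ) (path-along w i<j)) (acyclic _)

  height : ℕ → Fin n → ℕ
  height-via : ℕ → Fin n → Fin n → ℕ
  height zero _ = 0
  height (suc t) v = maxFin (height-via t v)
  height-via t v u = if does (R? u v) then suc (height t u) else 0

  height-walk : ∀ t v → Walk (height t v) v
  height-walk zero v = []
  height-walk (suc t) v with maxFin-attained (height-via t v)
  ... | inj₁ ≡0 = subst (λ k → Walk k v) (sym ≡0) []
  ... | inj₂ (u , ≡u) = subst (λ k → Walk k v) (sym ≡u) (walk-via u)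
    where
    walk-via : ∀ u → Walk (height-via t v u) v
    walk-via u with R? u v
    ... | yes a = height-walk t u ▷ a
    ... | no _ = []

  walk-height : ∀ t {k v} → Walk k v → k ≤ t → k ≤ height t v
  walk-height t [] _ = z≤n
  walk-height (suc t) {v = v} (_▷_ {u = u} w a) (s≤s k≤t) = begin
    suc _                 ≤⟨ s≤s (walk-height t w k≤t) ⟩
    suc (height t u)      ≡⟨ cong (λ b → if b then suc (height t u) else 0) (dec-true (R? u v) a) ⟨
    height-via t v u      ≤⟨ ≤-maxFin (height-via t v) u ⟩
    height (suc t) v      ∎
    where open ≤-Reasoning

  rank : Fin n → ℕ
  rank = height n

  rank-< : ∀ {u v} → R u v → rank u < rank v
  rank-< {u} a = walk-height n (height-walk n u ▷ a) (<⇒≤ (walk-length< (height-walk n u ▷ a)))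

module Lexicographic {m : ℕ} (σ : Fin m → ℕ) where

  lex : Fin m → ℕ
  lex e = toℕ e + σ e * m

  lex-mono : ∀ {e f} → σ e < σ f → lex e < lex f
  lex-mono {e} {f} σe<σf = begin-strict
    toℕ e + σ e * m  <⟨ +-monoˡ-< (σ e * m) (toℕ<n e) ⟩
    suc (σ e) * m    ≤⟨ *-monoˡ-≤ m σe<σf ⟩
    σ f * m          ≤⟨ m≤n+m (σ f * m) (toℕ f) ⟩
    lex f            ∎
    where open ≤-Reasoning

  lex-injective : ∀ {e f} → lex e ≡ lex f → e ≡ f
  lex-injective {e} {f} eq with <-cmp (σ e) (σ f)
  ... | tri< σe<σf _ _ = contradiction eq (<⇒≢ (lex-mono σe<σf))
  ... | tri> _ _ σe>σf = contradiction (sym eq) (<⇒≢ (lex-mono σe>σf))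
  ... | tri≈ _ σe≡σf _ =
    toℕ-injective (+-cancelʳ-≡ (σ e * m) _ _ (trans eq (cong (λ s → toℕ f + s * m) (sym σe≡σf))))

<?-suc : ∀ x k → does (x <? suc k) ≡ does (x <? k) ∨ does (x ≟ℕ k)
<?-suc x k with <-cmp x k
... | tri< x<k _ _
  rewrite dec-true (x <? suc k) (m<n⇒m<1+n x<k) | dec-true (x <? k) x<k = refl
... | tri≈ _ refl _
  rewrite dec-true (x <? suc x) (n<1+n x) | dec-false (x <? x) (n≮n x) | dec-true (x ≟ℕ x) refl = refl
... | tri> x≮k x≢k k<x
  rewrite dec-false (x <? suc k) (≤⇒≯ k<x) | dec-false (x <? k) x≮k | dec-false (x ≟ℕ k) x≢k = refl

-- Reduced P is S after reducing the edges in P: the nodes consumed as their inputs have been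
-- traded for their remainders.
module Reduction (G : ReductionGraph) where
  open ReductionGraph G
  open SetAlgebra

  consumed : (Fin m → Bool) → Fin n → Bool
  consumed P v = maybe′ P false (inp v)

  Nodes : (Fin m → Bool) → SubsetN
  Nodes P = FamSum (Restrict (not ∘ consumed P) X)

  Rems : (Fin m → Bool) → SubsetN
  Rems P = FamSum (Restrict P Rem)

  Reduced : (Fin m → Bool) → SubsetN
  Reduced P = Nodes P ⊞ Rems P

  insert : Fin m → (Fin m → Bool) → Fin m → Bool
  insert e P f = P f ∨ eqFin e f

  Reduced-cong : ∀ {P Q} → (∀ e → P e ≡ Q e) → Reduced P ≐ Reduced Q
  Reduced-cong {P} {Q} P≡Q = ⊞-cong (Restrict-cong X consumed≡) (Restrict-cong Rem P≡Q)
    where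
    consumed≡ : ∀ v → not (consumed P v) ≡ not (consumed Q v)
    consumed≡ v with inp v
    ... | nothing = refl
    ... | just e = cong not (P≡Q e)

  Reduced-none : Reduced (λ _ → false) ≐ S
  Reduced-none = ≐-trans (⊞-cong (Restrict-cong X unconsumed) FamSum-Zero) ⊞-identityʳ
    where
    unconsumed : ∀ v → not (consumed (λ _ → false) v) ≡ true
    unconsumed v with inp v
    ... | nothing = refl
    ... | just _ = refl

  Reduced-all : Reduced (λ _ → true) ≐ (⟨ r ⟩ ⊞ FamSum Rem)
  Reduced-all = ⊞-congʳ (≐-trans (Restrict-cong X only-root) (≐-trans (FamSum-Restrict-eqFin root X) root-set))
    where
    only-root : ∀ v → not (consumed (λ _ → true) v) ≡ eqFin root v
    only-root v with inp v in eq
    ... | nothing rewrite proj₁ (root-unique v) eq = sym (eqFin-refl root)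
    ... | just e = sym (eqFin-≢ λ root≡v → just≢nothing (trans (sym eq) (proj₂ (root-unique v) (sym root≡v))))
      where
      just≢nothing : just e ≢ nothing
      just≢nothing ()

  -- An edge may be reduced once no output of it is consumed: its inputs are then replaced,
  -- through Outputs e + Inputs e = Outputs e ⊕ Rem e, by its remainder.
  Reduced-insert : ∀ {P} e → P e ≡ false → (∀ v → out e v ≡ true → consumed (insert e P) v ≡ false)
    → Reduced P ≐ Reduced (insert e P)
  Reduced-insert {P} e Pe≡false outputs-free = begin
    Nodes P ⊞ Rems P             ≈⟨ ⊞-congʳ nodes ⟩
    (Nodes P′ ⊞ Rem e) ⊞ Rems P  ≈⟨ ⊞-assoc ⟩
    Nodes P′ ⊞ (Rem e ⊞ Rems P)  ≈⟨ ⊞-congˡ ⊞-comm ⟩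
    Nodes P′ ⊞ (Rems P ⊞ Rem e)  ≈⟨ ⊞-congˡ rems ⟨
    Nodes P′ ⊞ Rems P′           ∎
    where
    open ≐-Reasoning
    P′ : Fin m → Bool
    P′ = insert e P

    inputs-of-e : ∀ v → Splits (not (consumed P v)) (not (consumed P′ v)) (isInputOf (inp v) e)
    inputs-of-e v with inp v
    ... | nothing = left
    ... | just f with f ≟F e
    ...   | yes refl rewrite Pe≡false | eqFin-refl e = right
    ...   | no f≢e rewrite eqFin-≢ f≢e | eqFin-≢ (f≢e ∘ sym) | ∨-identityʳ (P f) with P f
    ...     | true = none
    ...     | false = left

    Others : Fin n → SubsetN
    Others = Restrict (λ v → not (consumed P′ v) ∧ not (out e v)) X

    outputs-of-e : ∀ v → Splits (not (consumed P′ v)) (not (consumed P′ v) ∧ not (out e v)) (out e v)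
    outputs-of-e v with out e v in out≡
    ... | true rewrite outputs-free v out≡ = right
    ... | false with not (consumed P′ v)
    ...   | true = left
    ...   | false = none

    nodes : Nodes P ≐ (Nodes P′ ⊞ Rem e)
    nodes = begin
      Nodes P                                  ≈⟨ Restrict-splits X inputs-of-e ⟩
      Nodes P′ ⊞ Inputs e                      ≈⟨ ⊞-congʳ (Restrict-splits X outputs-of-e) ⟩
      (FamSum Others ⊞ Outputs e) ⊞ Inputs e   ≈⟨ ⊞-assoc ⟩
      FamSum Others ⊞ (Outputs e ⊞ Inputs e)   ≈⟨ ⊞-congˡ (proj₁ (edge-rem e)) ⟩
      FamSum Others ⊞ (Outputs e ⊞ Rem e)      ≈⟨ ⊞-assoc ⟨
      (FamSum Others ⊞ Outputs e) ⊞ Rem e      ≈⟨ ⊞-congʳ (Restrict-splits X outputs-of-e) ⟨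
      Nodes P′ ⊞ Rem e                         ∎

    new-edge : ∀ f → Splits (P′ f) (P f) (eqFin e f)
    new-edge f with e ≟F f
    ... | yes refl rewrite Pe≡false | eqFin-refl e = right
    ... | no e≢f rewrite eqFin-≢ e≢f | ∨-identityʳ (P f) with P f
    ...   | true = left
    ...   | false = none

    rems : Rems P′ ≐ (Rems P ⊞ Rem e)
    rems = ≐-trans (Restrict-splits Rem new-edge) (⊞-congˡ (FamSum-Restrict-eqFin e Rem))

  Arrow? : Decidable Arrow
  Arrow? u v with inp u
  ... | nothing = no λ { (_ , () , _) }
  ... | just e with out e v in out≡
  ...   | true = yes (e , refl , out≡)
  ...   | false = no λ { (_ , refl , out≡true) → contradiction (trans (sym out≡) out≡true) λ () }

  open Ranking Arrow? acyclic using (rank; rank-<)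

  inputHeight : Fin m → Fin n → ℕ
  inputHeight e u = if isInputOf (inp u) e then suc (rank u) else 0

  edgeRank : Fin m → ℕ
  edgeRank e = maxFin (inputHeight e)

  isInputOf-sound : ∀ x (e : Fin m) → isInputOf x e ≡ true → x ≡ just e
  isInputOf-sound (just f) e eq = cong just (eqFin-sound eq)

  edgeRank-< : ∀ {e f v} → out e v ≡ true → inp v ≡ just f → edgeRank e < edgeRank f
  edgeRank-< {e} {f} {v} out≡ inp≡ = begin-strict
    edgeRank e        ≤⟨ maxFin-lub (inputHeight e) below-v ⟩
    rank v            <⟨ n<1+n (rank v) ⟩
    suc (rank v)      ≡⟨ cong (λ b → if b then suc (rank v) else 0) v-input-of-f ⟨
    inputHeight f v   ≤⟨ ≤-maxFin (inputHeight f) v ⟩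
    edgeRank f        ∎
    where
    open ≤-Reasoning
    below-v : ∀ u → inputHeight e u ≤ rank v
    below-v u with isInputOf (inp u) e in eq
    ... | true = rank-< (e , isInputOf-sound (inp u) e eq , out≡)
    ... | false = z≤n
    v-input-of-f : isInputOf (inp v) f ≡ true
    v-input-of-f rewrite inp≡ = eqFin-refl f

  open Lexicographic edgeRank using (lex; lex-mono; lex-injective)

  Before : ℕ → Fin m → Bool
  Before k e = does (lex e <? k)

  Reduced-Before-suc : ∀ k → Reduced (Before k) ≐ Reduced (Before (suc k))
  Reduced-Before-suc k with any? (λ (e : Fin m) → lex e ≟ℕ k)
  ... | no ∄e = Reduced-cong λ f → sym (begin
    Before (suc k) f                    ≡⟨ <?-suc (lex f) k ⟩
    Before k f ∨ does (lex f ≟ℕ k)      ≡⟨ cong (Before k f ∨_) (dec-false (lex f ≟ℕ k) (∄e ∘ (f ,_))) ⟩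
    Before k f ∨ false                  ≡⟨ ∨-identityʳ (Before k f) ⟩
    Before k f                          ∎)
    where open ≡-Reasoning
  ... | yes (e , lex-e≡k) = ≐-trans (Reduced-insert e e-unreduced outputs-free) (Reduced-cong insert≡Before)
    where
    eqFin-e : ∀ f → eqFin e f ≡ does (lex f ≟ℕ k)
    eqFin-e f with lex f ≟ℕ k
    ... | yes lex-f≡k rewrite dec-true (lex f ≟ℕ k) lex-f≡k | lex-injective (trans lex-e≡k (sym lex-f≡k)) =
      eqFin-refl f
    ... | no lex-f≢k rewrite dec-false (lex f ≟ℕ k) lex-f≢k = eqFin-≢ {i = e} λ { refl → lex-f≢k lex-e≡k }

    insert≡Before : ∀ f → insert e (Before k) f ≡ Before (suc k) f
    insert≡Before f = trans (cong (Before k f ∨_) (eqFin-e f)) (sym (<?-suc (lex f) k))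

    e-unreduced : Before k e ≡ false
    e-unreduced = dec-false (lex e <? k) (<-irrefl lex-e≡k)

    outputs-free : ∀ v → out e v ≡ true → consumed (insert e (Before k)) v ≡ false
    outputs-free v out≡ with inp v in inp≡
    ... | nothing = refl
    ... | just f = trans (insert≡Before f) (dec-false (lex f <? suc k) (≤⇒≯ k<lex-f))
      where
      k<lex-f : k < lex f
      k<lex-f = subst (_< lex f) lex-e≡k (lex-mono (edgeRank-< out≡ inp≡))

  S≐Reduced-Before : ∀ k → S ≐ Reduced (Before k)
  S≐Reduced-Before zero = ≐-trans (≐-sym Reduced-none) (Reduced-cong λ e → sym (dec-false (lex e <? 0) λ ()))
  S≐Reduced-Before (suc k) = ≐-trans (S≐Reduced-Before k) (Reduced-Before-suc k)

  S-decomposition : S ≐ (⟨ r ⟩ ⊞ FamSum Rem)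
  S-decomposition = ≐-trans (S≐Reduced-Before (suc (maxFin lex))) (≐-trans (Reduced-cong all-before) Reduced-all)
    where
    all-before : ∀ e → Before (suc (maxFin lex)) e ≡ true
    all-before e = dec-true (lex e <? suc (maxFin lex)) (s≤s (≤-maxFin lex e))

sumFin-cong : ∀ {k} {f g : Fin k → ℕ} → (∀ i → f i ≡ g i) → sumFin f ≡ sumFin g
sumFin-cong {zero} _ = refl
sumFin-cong {suc k} f≡g = cong₂ _+_ (f≡g zero) (sumFin-cong (f≡g ∘ suc))

piToFin : ∀ {k} (v : Fin k → ℕ) → ((i : Fin k) → Fin (v i)) → Fin (prodFin v)
piToFin {zero} v t = zero
piToFin {suc k} v t = combine (t zero) (piToFin (v ∘ suc) (t ∘ suc))

finToPi : ∀ {k} (v : Fin k → ℕ) → Fin (prodFin v) → (i : Fin k) → Fin (v i)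
finToPi {suc k} v j zero = proj₁ (remQuot {v zero} (prodFin (v ∘ suc)) j)
finToPi {suc k} v j (suc i) = finToPi (v ∘ suc) (proj₂ (remQuot {v zero} (prodFin (v ∘ suc)) j)) i

finToPi-piToFin : ∀ {k} (v : Fin k → ℕ) t i → finToPi v (piToFin v t) i ≡ t i
finToPi-piToFin {suc k} v t zero = cong proj₁ (remQuot-combine (t zero) (piToFin (v ∘ suc) (t ∘ suc)))
finToPi-piToFin {suc k} v t (suc i) = trans
  (cong (λ qr → finToPi (v ∘ suc) (proj₂ qr) i) (remQuot-combine (t zero) (piToFin (v ∘ suc) (t ∘ suc))))
  (finToPi-piToFin (v ∘ suc) (t ∘ suc) i)

injective⇒surjective : ∀ {k} {h : Fin k → Fin k} → (∀ {a b} → h a ≡ h b → a ≡ b)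
  → ∀ i → ∃ λ a → h a ≡ i
injective⇒surjective {suc k} {h} h-injective i with any? (λ a → h a ≟F i)
... | yes hit = hit
... | no miss = contradiction (injective⇒≤ squeezed-injective) (n≮n k)
  where
  i≢h : ∀ a → i ≢ h a
  i≢h a i≡ha = miss (a , sym i≡ha)
  squeezed : Fin (suc k) → Fin k
  squeezed a = punchOut (i≢h a)
  squeezed-injective : ∀ {a b} → squeezed a ≡ squeezed b → a ≡ b
  squeezed-injective {a} {b} eq = h-injective (punchOut-injective (i≢h a) (i≢h b) eq)

surjective⇒injective : ∀ {k} {F : Fin k → Fin k} → (∀ c → ∃ λ i → F i ≡ c)
  → ∀ {i j} → F i ≡ F j → i ≡ j
surjective⇒injective {k} {F} F-surjective {i} {j} Fi≡Fj = trans (sym (h∘F i)) (trans (cong h Fi≡Fj) (h∘F j))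
  where
  h : Fin k → Fin k
  h c = proj₁ (F-surjective c)
  F∘h : ∀ c → F (h c) ≡ c
  F∘h c = proj₂ (F-surjective c)
  h-injective : ∀ {a b} → h a ≡ h b → a ≡ b
  h-injective {a} {b} ha≡hb = trans (sym (F∘h a)) (trans (cong F ha≡hb) (F∘h b))
  h∘F : ∀ i → h (F i) ≡ i
  h∘F i with a , ha≡i ← injective⇒surjective h-injective i =
    trans (cong h (trans (cong F (sym ha≡i)) (F∘h a))) ha≡i

∈⇒≤sum : ∀ {x} {L : List ℕ} → x ∈ L → x ≤ sum L
∈⇒≤sum {L = y ∷ L} (here refl) = m≤m+n y (sum L)
∈⇒≤sum {L = y ∷ L} (there x∈L) = ≤-trans (∈⇒≤sum x∈L) (m≤n+m (sum L) y)

complement⊆list⇒eventually : ∀ {A : SubsetN} (L : List ℕ) → (∀ x → ¬ A x → x ∈ L)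
  → ∀ {x} → sum L < x → ¬ ¬ A x
complement⊆list⇒eventually L complement⊆L sumL<x x∉A = <⇒≱ sumL<x (∈⇒≤sum (complement⊆L _ x∉A))

common-divisor≡1 : ∀ {A : SubsetN} {N} → (∀ {x} → N < x → ¬ ¬ A x)
  → ∀ {d} → (∀ x → A x → d ∣ x) → d ≡ 1
common-divisor≡1 {N = N} eventually {d} d∣A =
  ∣1⇒≡1 (∣m+n∣m⇒∣n (subst (d ∣_) (+-comm 1 (suc N)) (d∣large (m<n⇒m<1+n (n<1+n N)))) (d∣large (n<1+n N)))
  where
  -- d ∣ x is decidable, so ¬ ¬ A x suffices
  d∣large : ∀ {x} → N < x → d ∣ x
  d∣large {x} N<x with d ∣? x
  ... | yes d∣x = d∣x
  ... | no d∤x = contradiction (λ Ax → d∤x (d∣A x Ax)) (eventually N<x)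

module AperyOfDecomposition
  {k : ℕ} (rem : Fin k → List ℕ) ⦃ _ : NonZero (prodFin (length ∘ rem)) ⦄
  {A : SubsetN} (N : ℕ) (eventually-in-A : ∀ {x} → N < x → ¬ ¬ A x)
  (decomposition : A ≐ (⟨ prodFin (length ∘ rem) ⟩ ⊞ FamSum (λ e x → x ∈ rem e)))
  where

  P : ℕ
  P = prodFin (length ∘ rem)

  Choice : (Fin k → ℕ) → Set
  Choice f = ∀ e → f e ∈ rem e

  A-elim : ∀ {x} → A x → ∃₂ λ q f → Choice f × sumFin f + q * P ≡ x
  A-elim {x} Ax with proj₁ (decomposition x) Ax
  ... | _ , _ , (q , refl) , (f , f∈rem , refl) , Pq+Σf≡x =
    q , f , f∈rem , trans (+-comm (sumFin f) (q * P)) (trans (cong (_+ sumFin f) (*-comm q P)) Pq+Σf≡x)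

  A-intro : ∀ q {f} → Choice f → A (sumFin f + q * P)
  A-intro q {f} f∈rem = proj₂ (decomposition _)
    (P * q , sumFin f , (q , refl) , (f , f∈rem , refl) , trans (cong (_+ sumFin f) (*-comm P q)) (+-comm (q * P) (sumFin f)))

  Tuple : Set
  Tuple = (e : Fin k) → Fin (length (rem e))

  tupleSum : Tuple → ℕ
  tupleSum t = sumFin (λ e → lookup (rem e) (t e))

  code : ∀ {f} → Choice f → Fin P
  code f∈rem = piToFin (length ∘ rem) (λ e → index (f∈rem e))

  residue : Fin P → Fin P
  residue i = fromℕ< (m%n<n (tupleSum (finToPi (length ∘ rem) i)) P)

  toℕ-residue-code : ∀ {f} (f∈rem : Choice f) → toℕ (residue (code f∈rem)) ≡ sumFin f % P
  toℕ-residue-code f∈rem = trans (toℕ-fromℕ< _) (cong (_% P) (sumFin-cong λ e → begin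
    lookup (rem e) (finToPi (length ∘ rem) (code f∈rem) e)  ≡⟨ cong (lookup (rem e)) (finToPi-piToFin _ _ e) ⟩
    lookup (rem e) (index (f∈rem e))                        ≡⟨ lookup-index (f∈rem e) ⟨
    _                                                       ∎))
    where open ≡-Reasoning

  residue-surjective : ∀ c → ∃ λ i → residue i ≡ c
  residue-surjective c with any? (λ i → residue i ≟F c)
  ... | yes hit = hit
  ... | no miss = contradiction (miss ∘ hit) (eventually-in-A N<x)
    where
    x : ℕ
    x = toℕ c + suc N * P
    N<x : N < x
    N<x = <-≤-trans (n<1+n N) (≤-trans (m≤m*n (suc N) P) (m≤n+m (suc N * P) (toℕ c)))
    hit : A x → ∃ λ i → residue i ≡ c
    hit Ax with q , f , f∈rem , Σf+qP≡x ← A-elim Ax = code f∈rem , toℕ-injective (begin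
      toℕ (residue (code f∈rem))  ≡⟨ toℕ-residue-code f∈rem ⟩
      sumFin f % P               ≡⟨ [m+kn]%n≡m%n (sumFin f) q P ⟨
      (sumFin f + q * P) % P     ≡⟨ cong (_% P) Σf+qP≡x ⟩
      x % P                      ≡⟨ [m+kn]%n≡m%n (toℕ c) (suc N) P ⟩
      toℕ c % P                  ≡⟨ m<n⇒m%n≡m (toℕ<n c) ⟩
      toℕ c                      ∎)
      where open ≡-Reasoning

  choice-unique-mod : ∀ {f g} (f∈rem : Choice f) (g∈rem : Choice g)
    → sumFin f % P ≡ sumFin g % P → ∀ e → f e ≡ g e
  choice-unique-mod {f} {g} f∈rem g∈rem Σf≡Σg e = begin
    f e                                                    ≡⟨ lookup-index (f∈rem e) ⟩
    lookup (rem e) (index (f∈rem e))                       ≡⟨ cong (lookup (rem e)) (finToPi-piToFin _ _ e) ⟨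
    lookup (rem e) (finToPi (length ∘ rem) (code f∈rem) e)  ≡⟨ cong (λ i → lookup (rem e) (finToPi (length ∘ rem) i e)) same-code ⟩
    lookup (rem e) (finToPi (length ∘ rem) (code g∈rem) e)  ≡⟨ cong (lookup (rem e)) (finToPi-piToFin _ _ e) ⟩
    lookup (rem e) (index (g∈rem e))                       ≡⟨ lookup-index (g∈rem e) ⟨
    g e                                                    ∎
    where
    open ≡-Reasoning
    same-code : code f∈rem ≡ code g∈rem
    same-code = surjective⇒injective residue-surjective
      (toℕ-injective (trans (toℕ-residue-code f∈rem) (trans Σf≡Σg (sym (toℕ-residue-code g∈rem)))))

  direct : FamDirect (λ e x → x ∈ rem e)
  direct f g f∈rem g∈rem Σf≡Σg = choice-unique-mod f∈rem g∈rem (cong (_% P) Σf≡Σg)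

  Ap⊆FamSum : ∀ {s} → Ap A P s → FamSum (λ e x → x ∈ rem e) s
  Ap⊆FamSum (As , s-P∉A) with A-elim As
  ... | zero , f , f∈rem , Σf+0≡s = f , f∈rem , trans (sym (+-identityʳ (sumFin f))) Σf+0≡s
  ... | suc q , f , f∈rem , refl = contradiction (P≤s , subst A s-P≡ (A-intro q f∈rem)) s-P∉A
    where
    shift : sumFin f + suc q * P ≡ P + (sumFin f + q * P)
    shift = x∙yz≈y∙xz (sumFin f) P (q * P)
    P≤s : P ≤ sumFin f + suc q * P
    P≤s = subst (P ≤_) (sym shift) (m≤m+n P _)
    s-P≡ : sumFin f + q * P ≡ sumFin f + suc q * P ∸ P
    s-P≡ = sym (trans (cong (_∸ P) shift) (m+n∸m≡n P _))

  FamSum⊆Ap : ∀ {s} → FamSum (λ e x → x ∈ rem e) s → Ap A P s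
  FamSum⊆Ap (f , f∈rem , refl) = subst A (+-identityʳ (sumFin f)) (A-intro 0 f∈rem) , Σf-P∉A
    where
    Σf-P∉A : ¬ (Σ (P ≤ sumFin f) λ _ → A (sumFin f ∸ P))
    Σf-P∉A (P≤Σf , A[Σf-P]) with q , g , g∈rem , Σg+qP≡Σf-P ← A-elim A[Σf-P] =
      <-irrefl (trans (sym (sumFin-cong f≡g)) Σf≡) (m<m+n (sumFin g) (<-≤-trans (>-nonZero⁻¹ P) (m≤m+n P (q * P))))
      where
      open ≡-Reasoning
      Σf≡ : sumFin f ≡ sumFin g + suc q * P
      Σf≡ = begin
        sumFin f                ≡⟨ m∸n+n≡m P≤Σf ⟨
        sumFin f ∸ P + P        ≡⟨ cong (_+ P) Σg+qP≡Σf-P ⟨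
        sumFin g + q * P + P    ≡⟨ +-assoc (sumFin g) (q * P) P ⟩
        sumFin g + (q * P + P)  ≡⟨ cong (sumFin g +_) (+-comm (q * P) P) ⟩
        sumFin g + suc q * P    ∎
      f≡g : ∀ e → f e ≡ g e
      f≡g = choice-unique-mod f∈rem g∈rem (trans (cong (_% P) Σf≡) ([m+kn]%n≡m%n (sumFin g) (suc q) P))

  Ap≐FamSum : Ap A P ≐ FamSum (λ e x → x ∈ rem e)
  Ap≐FamSum s = Ap⊆FamSum , FamSum⊆Ap

theorem3p1 : (G : ReductionGraph) → Total G
    → IsNumericalSemigroup (ReductionGraph.S G)
    → FamDirect (ReductionGraph.Rem G)
      × (Ap (ReductionGraph.S G) (ReductionGraph.r G) ≐ FamSum (ReductionGraph.Rem G))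
theorem3p1 G (d , (d∣S , _) , r≡d*∏w) (_ , _ , L , complement⊆L) =
  direct , subst (λ a → Ap S a ≐ FamSum Rem) (sym r≡∏w) Ap≐FamSum
  where
  open ReductionGraph G

  eventually-in-S : ∀ {x} → sum L < x → ¬ ¬ S x
  eventually-in-S = complement⊆list⇒eventually L complement⊆L

  r≡∏w : r ≡ prodFin w
  r≡∏w = trans r≡d*∏w (trans (cong (_* prodFin w) (common-divisor≡1 eventually-in-S d∣S)) (*-identityˡ _))

  instance
    ∏w≢0 : NonZero (prodFin w)
    ∏w≢0 = >-nonZero (subst (0 <_) r≡∏w r-pos)

  S≐⟨∏w⟩⊞ΣRem : S ≐ (⟨ prodFin w ⟩ ⊞ FamSum Rem)
  S≐⟨∏w⟩⊞ΣRem = subst (λ a → S ≐ (⟨ a ⟩ ⊞ FamSum Rem)) r≡∏w (Reduction.S-decomposition G)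

  open AperyOfDecomposition rem (sum L) eventually-in-S S≐⟨∏w⟩⊞ΣRem
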